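{- Let $p$ be an odd prime and $m\ge1$ an integer, and let $\alpha^{(1)},\dots,\alpha^{(m)}\in\mathbb{Q}_p$. Run the $p$-adic Jacobi–Perron algorithm: $\alpha_0^{(i)}=\alpha^{(i)}$ and for $n=0,1,2,\dots$ $$a_n^{(i)}=s(\alpha_n^{(i)})\ (i=1,\dots,m),\quad \alpha_{n+1}^{(1)}=\frac{1}{\alpha_n^{(m)}-a_n^{(m)}},\quad \alpha_{n+1}^{(i)}=\frac{\alpha_n^{(i-1)}-a_n^{(i-1)}}{\alpha_n^{(m)}-a_n^{(m)}}\ (i=2,\dots,m),$$ where the algorithm stops at step $n$ if $\alpha_n^{(m)}=a_n^{(m)}$. If the algorithm stops after finitely many steps, then $1,\alpha^{(1)},\dots,\alpha^{(m)}$ are linearly dependent over $\mathbb{Q}$.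
   Context: $s$ is the Browkin function: writing $\alpha\in\mathbb{Q}_p$ uniquely as $\alpha=\sum_{j=k}^\infty x_jp^j$ with $k\in\mathbb{Z}$, $x_j\in\mathbb{Z}\cap(-\frac p2,\frac p2)$, set $s(\alpha)=\sum_{j=k}^0x_jp^j$. -}

module Defs where

open import Data.Nat as ℕ using (ℕ; zero; suc; NonZero; _≤_; _<_)
open import Data.Nat.Properties using (m^n≢0)
open import Data.Nat.Divisibility using (_∣_)
open import Data.Integer as ℤ using (ℤ; +_)
open import Data.Rational as ℚ using (ℚ; _/_; ↥_; ↧ₙ_; 0ℚ; 1ℚ)
open import Relation.Binary.PropositionalEquality using (_≡_)
open import Data.Product using (Σ; ∃; _×_)
open import Relation.Nullary using (¬_)

-- The field ℚ_p, constructed as the completion of ℚ w.r.t. the p-adic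
-- absolute value: p-adic Cauchy sequences of rationals, with equality
-- "the difference tends to 0 p-adically" and pointwise operations.

module _ (p : ℕ) ⦃ _ : NonZero p ⦄ where

  -- q ∈ p^M ℤ_(p)   (i.e. |q|_p ≤ p^{-M})
  InPow : ℕ → ℚ → Set
  InPow M q = (p ℕ.^ M) ∣ ℤ.∣ ↥ q ∣ × ¬ (p ∣ ↧ₙ q)

  Seq : Set
  Seq = ℕ → ℚ

  IsCauchy : Seq → Set
  IsCauchy x = ∀ M → ∃ λ N → ∀ k l → N ≤ k → N ≤ l → InPow M (x k ℚ.- x l)

  record ℚp : Set where
    constructor mkℚp
    field
      seq    : Seq
      cauchy : IsCauchy seq
  open ℚp public

  -- β ∈ p^M ℤ_p  for a (Cauchy) sequence β
  InPowSeq : ℕ → Seq → Set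
  InPowSeq M β = ∃ λ N → ∀ k → N ≤ k → InPow M (β k)

  _≈_ : Seq → Seq → Set
  x ≈ y = ∀ M → InPowSeq M (λ k → x k ℚ.- y k)

  ι : ℚ → Seq
  ι q k = q

  _⊕_ : Seq → Seq → Seq
  (x ⊕ y) k = x k ℚ.+ y k

  _⊖_ : Seq → Seq → Seq
  (x ⊖ y) k = x k ℚ.- y k

  _⊗_ : Seq → Seq → Seq
  (x ⊗ y) k = x k ℚ.* y k

  -- A p-adic expansion with balanced digits, starting at position -K:
  --   α = Σ_{i ≥ 0} x_i p^{i-K},   x_i ∈ ℤ ∩ (-p/2, p/2).
  -- (Starting positions k ≥ 0 of the paper are covered by K = 0 with
  -- leading zero digits.)

  Balanced : ℤ → Set
  Balanced d = 2 ℕ.* ℤ.∣ d ∣ < p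

  digitSum : (ℕ → ℤ) → ℕ → ℤ
  digitSum x zero    = x 0
  digitSum x (suc N) = digitSum x N ℤ.+ x (suc N) ℤ.* (+ (p ℕ.^ suc N))

  partialSum : ℕ → (ℕ → ℤ) → ℕ → ℚ
  partialSum K x N = _/_ (digitSum x N) (p ℕ.^ K) ⦃ m^n≢0 p K ⦄

  IsExpansion : Seq → ℕ → (ℕ → ℤ) → Set
  IsExpansion α K x =
    (∀ i → Balanced (x i)) ×
    (∀ N → K ≤ N → InPowSeq (suc N ℕ.∸ K) (α ⊖ ι (partialSum K x N)))

  -- a = s(α): a is the sum of the terms of the expansion of α at
  -- positions ≤ 0, i.e. Σ_{i=0}^{K} x_i p^{i-K}.
  IsBrowkin : Seq → ℚ → Set
  IsBrowkin α a = ∃ λ K → ∃ λ x → IsExpansion α K x × a ≡ partialSum K x K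

  linComb : (ℕ → ℚ) → (ℕ → ℚp) → ℕ → Seq
  linComb c α zero    = ι 0ℚ
  linComb c α (suc i) = linComb c α i ⊕ (ι (c (suc i)) ⊗ seq (α (suc i)))

  LinDep : ℕ → (ℕ → ℚp) → Set
  LinDep m α = Σ (ℕ → ℚ) λ c →
    (∃ λ i → i ≤ m × ¬ (c i ≡ 0ℚ)) × (ι (c 0) ⊕ linComb c α m) ≈ ι 0ℚ

  -- A n i = α_n^{(i)}, a n i = a_n^{(i)} (meaningful for 1 ≤ i ≤ m).
  -- Division z = u / v in ℚ_p is expressed as v ≉ 0 and z·v = u.
  record JPStopsAt (m : ℕ) (α : ℕ → ℚp) (T : ℕ) (A : ℕ → ℕ → ℚp) (a : ℕ → ℕ → ℚ) : Set where
    field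
      init    : ∀ i → 1 ≤ i → i ≤ m → seq (A 0 i) ≈ seq (α i)
      digits  : ∀ n i → n ≤ T → 1 ≤ i → i ≤ m → IsBrowkin (seq (A n i)) (a n i)
      running : ∀ n → n < T → ¬ (seq (A n m) ≈ ι (a n m))
      step₁   : ∀ n → n < T →
                  (seq (A (suc n) 1) ⊗ (seq (A n m) ⊖ ι (a n m))) ≈ ι 1ℚ
      stepᵢ   : ∀ n i → n < T → 2 ≤ i → i ≤ m →
                  (seq (A (suc n) i) ⊗ (seq (A n m) ⊖ ι (a n m)))
                    ≈ (seq (A n (i ℕ.∸ 1)) ⊖ ι (a n (i ℕ.∸ 1)))
      stops   : seq (A T m) ≈ ι (a T m)

  JPStops : ℕ → (ℕ → ℚp) → Set
  JPStops m α = ∃ λ T → Σ (ℕ → ℕ → ℚp) λ A → Σ (ℕ → ℕ → ℚ) λ a → JPStopsAt m α T A a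

{-# OPTIONS --safe #-}

-- Multiplying a relation c₀ + Σᵢ cᵢ α_{n+1}^{(i)} = 0 by α_n^{(m)} − a_n^{(m)} and using
-- the recursion gives a relation c′ among 1, α_n^{(1)}, …, α_n^{(m)}; the map c ↦ c′ is
-- injective, so c′ is nontrivial when c is. At the stopping step α_T^{(m)} = a_T^{(m)} is
-- rational, which is a relation, and descending from n = T to n = 0 gives the theorem. Only
-- the rationality of the a_n^{(i)} is used: neither that they are Browkin digits nor that p
-- is odd matters. In ℚ_p, represented by Cauchy sequences, multiplying a null sequence by a
-- Cauchy sequence gives a null sequence because Cauchy sequences are p-adically bounded.

module Submission where

open import Data.Empty using (⊥-elim)
open import Data.Integer as ℤ using (ℤ; +_; +0; +[1+_]; -[1+_])
import Data.Integer.Divisibility.Signed as ℤ∣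
import Data.Integer.Properties as ℤ
open import Data.Nat as ℕ using (ℕ; zero; suc; NonZero; _^_; _<_; _≤_; _⊔_)
import Data.Nat.Coprimality as Coprime
open import Data.Nat.Divisibility
open import Data.Nat.Induction using (<-wellFounded)
open import Data.Nat.Primality using (Prime; euclidsLemma; prime⇒nonTrivial)
import Data.Nat.Properties as ℕ
open import Data.Product using (∃; ∃₂; _×_; _,_)
import Data.Rational as ℚ
open ℚ using (ℚ; mkℚ; 0ℚ; 1ℚ)
import Data.Rational.Properties as ℚₚ
open import Data.Rational.Unnormalised using (ℚᵘ; mkℚᵘ; _≃_; *≡*; _+_; _*_; _/_; 1ℚᵘ; 1/_)
import Data.Rational.Unnormalised.Properties as ℚᵘₚ
open import Data.Sum using ([_,_]′)
open import Function using (id; _∘_)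
open import Induction.WellFounded using (Acc; acc)
open import Level using (0ℓ)
open import Relation.Binary.Bundles using (Setoid)
open import Relation.Binary.PropositionalEquality
import Relation.Binary.Reasoning.Setoid as ≈-Reasoning
open import Relation.Nullary using (¬_; ¬?; yes; no)
open import Relation.Nullary.Decidable using (decidable-stable)

import Algebra.Properties.CommutativeSemigroup ℕ.*-commutativeSemigroup as ℕ*
import Data.Rational.Solver as ℚ-Solver
import Data.Rational.Unnormalised.Solver as ℚᵘ-Solver

open import Defs hiding (_≈_; _⊕_; _⊖_; _⊗_; ι)
import Defs as D

module PrimeDivisibility {p : ℕ} ⦃ _ : NonZero p ⦄ (p-prime : Prime p) where

  private instance
    p-nonTrivial : ℕ.NonTrivial p
    p-nonTrivial = prime⇒nonTrivial p-prime

  p∤1 : ¬ p ∣ 1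
  p∤1 p∣1 = ℕ.nonTrivial⇒≢1 (∣1⇒≡1 p∣1)

  p∤* : ∀ {m n} → ¬ p ∣ m → ¬ p ∣ n → ¬ p ∣ m ℕ.* n
  p∤* p∤m p∤n p∣mn = [ p∤m , p∤n ]′ (euclidsLemma _ _ p-prime p∣mn)

  p∣*-cancelʳ : ∀ {x b} → ¬ p ∣ b → p ∣ x ℕ.* b → p ∣ x
  p∣*-cancelʳ p∤b p∣xb = [ id , (λ p∣b → ⊥-elim (p∤b p∣b)) ]′ (euclidsLemma _ _ p-prime p∣xb)

  p^∣*-cancelʳ : ∀ M {x b} → ¬ p ∣ b → p ^ M ∣ x ℕ.* b → p ^ M ∣ x
  p^∣*-cancelʳ zero    {x} _   _        = 1∣ x
  p^∣*-cancelʳ (suc M) {x} {b} p∤b p^M⁺¹∣xb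
    with divides y refl ← p^∣*-cancelʳ M {x} p∤b (∣-trans (n∣m*n p) p^M⁺¹∣xb) =
    *-monoˡ-∣ (p ^ M) (p∣*-cancelʳ {y} p∤b (*-cancelʳ-∣ (p ^ M) p∣yb·p^M))
    where
    instance _ = ℕ.m^n≢0 p M
    p∣yb·p^M : p ℕ.* p ^ M ∣ y ℕ.* b ℕ.* p ^ M
    p∣yb·p^M = subst (p ℕ.* p ^ M ∣_) (ℕ*.xy∙z≈xz∙y y (p ^ M) b) p^M⁺¹∣xb

  p-free-factorisation : ∀ d → .⦃ NonZero d ⦄ → ∃₂ λ v u → d ≡ p ^ v ℕ.* u × ¬ p ∣ u
  p-free-factorisation d = go d (<-wellFounded d)
    where
    go : ∀ d → .⦃ NonZero d ⦄ → Acc _<_ d → ∃₂ λ v u → d ≡ p ^ v ℕ.* u × ¬ p ∣ u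
    go d _ with p ∣? d
    go d _          | no p∤d = 0 , d , sym (ℕ.+-identityʳ d) , p∤d
    go d (acc rec) | yes p∣d@(divides q refl)
      with v , u , refl , p∤u ← go q ⦃ quotient≢0 p∣d ⦄ (rec (quotient-< p∣d)) =
      suc v , u , ℕ*.xy∙z≈zx∙y (p ^ v) u p , p∤u

module Integralityᵘ {p : ℕ} ⦃ _ : NonZero p ⦄ (p-prime : Prime p) where
  open PrimeDivisibility p-prime
  open ℚᵘₚ using (*-congˡ; *-congʳ; +-cong; ≃-sym; ≃-trans)
  open ℚᵘₚ.≃-Reasoning
  open ℚᵘ-Solver.+-*-Solver using (solve; _:+_; _:*_; _:=_)

  ⟦_⟧ : ℤ → ℚᵘ
  ⟦ i ⟧ = i / 1

  ⟦+⟧ : ∀ i j → ⟦ i ℤ.+ j ⟧ ≃ ⟦ i ⟧ + ⟦ j ⟧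
  ⟦+⟧ i j = *≡* (cong (ℤ._* + 1) (cong₂ ℤ._+_ (sym (ℤ.*-identityʳ i)) (sym (ℤ.*-identityʳ j))))

  ⟦*⟧ : ∀ i j → ⟦ i ℤ.* j ⟧ ≃ ⟦ i ⟧ * ⟦ j ⟧
  ⟦*⟧ i j = *≡* refl

  ⟦+*⟧ : ∀ m n → ⟦ + (m ℕ.* n) ⟧ ≃ ⟦ + m ⟧ * ⟦ + n ⟧
  ⟦+*⟧ m n = ≃-trans (ℚᵘₚ.≃-reflexive (cong ⟦_⟧ (ℤ.pos-* m n))) (⟦*⟧ (+ m) (+ n))

  p^ᵘ : ℕ → ℚᵘ
  p^ᵘ M = ⟦ + (p ^ M) ⟧

  p^ᵘ-+ : ∀ M N → p^ᵘ (M ℕ.+ N) ≃ p^ᵘ M * p^ᵘ N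
  p^ᵘ-+ M N = ≃-trans (ℚᵘₚ.≃-reflexive (cong (⟦_⟧ ∘ +_) (ℕ.^-distribˡ-+-* p M N))) (⟦+*⟧ (p ^ M) (p ^ N))

  -- `InPow p M` reads off the reduced numerator and denominator; this form is invariant
  -- under `_≃_`, so closure under the ring operations can be proved on representatives.
  record InPowᵘ (M : ℕ) (x : ℚᵘ) : Set where
    constructor inPowᵘ
    field
      numerator     : ℤ
      denominator   : ℕ
      p∤denominator : ¬ p ∣ denominator
      equation      : x * ⟦ + denominator ⟧ ≃ p^ᵘ M * ⟦ numerator ⟧

  InPowᵘ-cong : ∀ {M x y} → x ≃ y → InPowᵘ M x → InPowᵘ M y
  InPowᵘ-cong x≃y (inPowᵘ a b p∤b xb≃) = inPowᵘ a b p∤b (≃-trans (*-congʳ (≃-sym x≃y)) xb≃)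

  InPowᵘ-+ : ∀ {M x y} → InPowᵘ M x → InPowᵘ M y → InPowᵘ M (x + y)
  InPowᵘ-+ {M} {x} {y} (inPowᵘ a b p∤b xb≃) (inPowᵘ a′ b′ p∤b′ yb′≃) =
    inPowᵘ (a ℤ.* + b′ ℤ.+ a′ ℤ.* + b) (b ℕ.* b′) (p∤* p∤b p∤b′) (begin
      (x + y) * ⟦ + (b ℕ.* b′) ⟧              ≈⟨ *-congˡ {x + y} (⟦+*⟧ b b′) ⟩
      (x + y) * (B * B′)                       ≈⟨ expand x y B B′ ⟩
      x * B * B′ + y * B′ * B                  ≈⟨ +-cong (*-congʳ xb≃) (*-congʳ yb′≃) ⟩
      P * ⟦ a ⟧ * B′ + P * ⟦ a′ ⟧ * B          ≈⟨ collect P ⟦ a ⟧ ⟦ a′ ⟧ B B′ ⟩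
      P * (⟦ a ⟧ * B′ + ⟦ a′ ⟧ * B)            ≈⟨ *-congˡ {P} (+-cong (⟦*⟧ a (+ b′)) (⟦*⟧ a′ (+ b))) ⟨
      P * (⟦ a ℤ.* + b′ ⟧ + ⟦ a′ ℤ.* + b ⟧)    ≈⟨ *-congˡ {P} (⟦+⟧ (a ℤ.* + b′) (a′ ℤ.* + b)) ⟨
      P * ⟦ a ℤ.* + b′ ℤ.+ a′ ℤ.* + b ⟧        ∎)
    where
    P = p^ᵘ M
    B = ⟦ + b ⟧
    B′ = ⟦ + b′ ⟧
    expand : ∀ x y B B′ → (x + y) * (B * B′) ≃ x * B * B′ + y * B′ * B
    expand = solve 4 (λ x y B B′ → (x :+ y) :* (B :* B′) := x :* B :* B′ :+ y :* B′ :* B) ℚᵘₚ.≃-refl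
    collect : ∀ P A A′ B B′ → P * A * B′ + P * A′ * B ≃ P * (A * B′ + A′ * B)
    collect = solve 5 (λ P A A′ B B′ →
      P :* A :* B′ :+ P :* A′ :* B := P :* (A :* B′ :+ A′ :* B)) ℚᵘₚ.≃-refl

  InPowᵘ-* : ∀ {M N x y} → InPowᵘ M x → InPowᵘ N y → InPowᵘ (M ℕ.+ N) (x * y)
  InPowᵘ-* {M} {N} {x} {y} (inPowᵘ a b p∤b xb≃) (inPowᵘ a′ b′ p∤b′ yb′≃) =
    inPowᵘ (a ℤ.* a′) (b ℕ.* b′) (p∤* p∤b p∤b′) (begin
      x * y * ⟦ + (b ℕ.* b′) ⟧                 ≈⟨ *-congˡ {x * y} (⟦+*⟧ b b′) ⟩
      x * y * (⟦ + b ⟧ * ⟦ + b′ ⟧)             ≈⟨ interchange x y ⟦ + b ⟧ ⟦ + b′ ⟧ ⟩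
      x * ⟦ + b ⟧ * (y * ⟦ + b′ ⟧)             ≈⟨ ℚᵘₚ.*-cong xb≃ yb′≃ ⟩
      p^ᵘ M * ⟦ a ⟧ * (p^ᵘ N * ⟦ a′ ⟧)         ≈⟨ interchange (p^ᵘ M) ⟦ a ⟧ (p^ᵘ N) ⟦ a′ ⟧ ⟩
      p^ᵘ M * p^ᵘ N * (⟦ a ⟧ * ⟦ a′ ⟧)         ≈⟨ ℚᵘₚ.*-cong (p^ᵘ-+ M N) (⟦*⟧ a a′) ⟨
      p^ᵘ (M ℕ.+ N) * ⟦ a ℤ.* a′ ⟧             ∎)
    where
    interchange : ∀ x y u v → x * y * (u * v) ≃ x * u * (y * v)
    interchange = solve 4 (λ x y u v → x :* y :* (u :* v) := x :* u :* (y :* v)) ℚᵘₚ.≃-refl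

  *-cancelʳ-p^ᵘ : ∀ e {u v} → u * p^ᵘ e ≃ v * p^ᵘ e → u ≃ v
  *-cancelʳ-p^ᵘ e {u} {v} ur≃vr = begin
    u              ≈⟨ divide u ⟩
    u * r * 1/ r   ≈⟨ *-congʳ ur≃vr ⟩
    v * r * 1/ r   ≈⟨ divide v ⟨
    v              ∎
    where
    r = p^ᵘ e
    instance _ = ℕ.m^n≢0 p e
    divide : ∀ w → w ≃ w * r * 1/ r
    divide w = begin
      w                ≈⟨ ℚᵘₚ.*-identityʳ w ⟨
      w * 1ℚᵘ          ≈⟨ *-congˡ {w} (ℚᵘₚ.*-inverseʳ r) ⟨
      w * (r * 1/ r)   ≈⟨ ℚᵘₚ.*-assoc w r (1/ r) ⟨
      w * r * 1/ r     ∎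

  InPowᵘ-cancel : ∀ {M} e {x} → InPowᵘ (M ℕ.+ e) (x * p^ᵘ e) → InPowᵘ M x
  InPowᵘ-cancel {M} e {x} (inPowᵘ a b p∤b xrb≃) = inPowᵘ a b p∤b (*-cancelʳ-p^ᵘ e (begin
    x * ⟦ + b ⟧ * p^ᵘ e            ≈⟨ swap x ⟦ + b ⟧ (p^ᵘ e) ⟩
    x * p^ᵘ e * ⟦ + b ⟧            ≈⟨ xrb≃ ⟩
    p^ᵘ (M ℕ.+ e) * ⟦ a ⟧          ≈⟨ *-congʳ (p^ᵘ-+ M e) ⟩
    p^ᵘ M * p^ᵘ e * ⟦ a ⟧          ≈⟨ swap (p^ᵘ M) (p^ᵘ e) ⟦ a ⟧ ⟩
    p^ᵘ M * ⟦ a ⟧ * p^ᵘ e          ∎))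
    where
    swap : ∀ x y z → x * y * z ≃ x * z * y
    swap = solve 3 (λ x y z → x :* y :* z := x :* z :* y) ℚᵘₚ.≃-refl

  InPowᵘ-integer : ∀ i → InPowᵘ 0 ⟦ i ⟧
  InPowᵘ-integer i = inPowᵘ i 1 p∤1 (ℚᵘₚ.*-comm ⟦ i ⟧ ⟦ + 1 ⟧)

  ⟦⟧-injective : ∀ {i j} → ⟦ i ⟧ ≃ ⟦ j ⟧ → i ≡ j
  ⟦⟧-injective {i} {j} (*≡* eq) = trans (sym (ℤ.*-identityʳ i)) (trans eq (ℤ.*-identityʳ j))

  *-denominator : ∀ n d → mkℚᵘ n d * ⟦ + suc d ⟧ ≃ ⟦ n ⟧
  *-denominator n d = *≡* (trans (ℤ.*-identityʳ _) (cong (λ k → n ℤ.* + k) (sym (ℕ.*-identityʳ (suc d)))))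

  InPowᵘ-clear-denominator : ∀ n d → ∃ λ e → InPowᵘ 0 (mkℚᵘ n d * p^ᵘ e)
  InPowᵘ-clear-denominator n d with v , u , d+1≡ , p∤u ← p-free-factorisation (suc d) =
    v , inPowᵘ n u p∤u (begin
      x * p^ᵘ v * ⟦ + u ⟧          ≈⟨ ℚᵘₚ.*-assoc x (p^ᵘ v) ⟦ + u ⟧ ⟩
      x * (p^ᵘ v * ⟦ + u ⟧)        ≈⟨ *-congˡ {x} (⟦+*⟧ (p ^ v) u) ⟨
      x * ⟦ + (p ^ v ℕ.* u) ⟧      ≡⟨ cong (λ k → x * ⟦ + k ⟧) d+1≡ ⟨
      x * ⟦ + suc d ⟧              ≈⟨ *-denominator n d ⟩
      ⟦ n ⟧                        ≈⟨ ℚᵘₚ.*-identityˡ ⟦ n ⟧ ⟨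
      p^ᵘ 0 * ⟦ n ⟧                ∎)
    where
    x = mkℚᵘ n d

module Integrality (p : ℕ) ⦃ _ : NonZero p ⦄ (p-prime : Prime p) where
  open PrimeDivisibility p-prime
  open Integralityᵘ p-prime
  open ℚᵘₚ using (*-congˡ; *-congʳ; ≃-sym; ≃-trans)
  open ℚᵘ-Solver.+-*-Solver using (solve; _:*_; _:=_)

  InPow⇒InPowᵘ : ∀ {M} q → InPow p M q → InPowᵘ M (ℚ.toℚᵘ q)
  InPow⇒InPowᵘ {M} (mkℚ n d _) (p^M∣n , p∤d+1)
    with ℤ∣.divides a n≡a*p^M ← ℤ∣.∣ᵤ⇒∣ {+ (p ^ M)} {n} p^M∣n =
    inPowᵘ a (suc d) p∤d+1 (begin
      mkℚᵘ n d * ⟦ + suc d ⟧     ≈⟨ *-denominator n d ⟩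
      ⟦ n ⟧                      ≡⟨ cong ⟦_⟧ (trans n≡a*p^M (ℤ.*-comm a (+ (p ^ M)))) ⟩
      ⟦ + (p ^ M) ℤ.* a ⟧        ≈⟨ ⟦*⟧ (+ (p ^ M)) a ⟩
      p^ᵘ M * ⟦ a ⟧              ∎)
    where open ℚᵘₚ.≃-Reasoning

  InPowᵘ⇒InPow : ∀ {M} q → InPowᵘ M (ℚ.toℚᵘ q) → InPow p M q
  InPowᵘ⇒InPow {M} (mkℚ n d coprime) (inPowᵘ a b p∤b xb≃) = p^M∣n , p∤d+1
    where
    nb≡ : n ℤ.* + b ≡ + (p ^ M) ℤ.* a ℤ.* + suc d
    nb≡ = ⟦⟧-injective (begin
      ⟦ n ℤ.* + b ⟧                        ≈⟨ ⟦*⟧ n (+ b) ⟩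
      ⟦ n ⟧ * ⟦ + b ⟧                      ≈⟨ *-congʳ (*-denominator n d) ⟨
      mkℚᵘ n d * ⟦ + suc d ⟧ * ⟦ + b ⟧     ≈⟨ swap (mkℚᵘ n d) ⟦ + suc d ⟧ ⟦ + b ⟧ ⟩
      mkℚᵘ n d * ⟦ + b ⟧ * ⟦ + suc d ⟧     ≈⟨ *-congʳ xb≃ ⟩
      p^ᵘ M * ⟦ a ⟧ * ⟦ + suc d ⟧          ≈⟨ *-congʳ (⟦*⟧ (+ (p ^ M)) a) ⟨
      ⟦ + (p ^ M) ℤ.* a ⟧ * ⟦ + suc d ⟧    ≈⟨ ⟦*⟧ (+ (p ^ M) ℤ.* a) (+ suc d) ⟨
      ⟦ + (p ^ M) ℤ.* a ℤ.* + suc d ⟧      ∎)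
      where
      open ℚᵘₚ.≃-Reasoning
      swap : ∀ x y z → x * y * z ≃ x * z * y
      swap = solve 3 (λ x y z → x :* y :* z := x :* z :* y) ℚᵘₚ.≃-refl
    ∣n∣b≡ : ℤ.∣ n ∣ ℕ.* b ≡ p ^ M ℕ.* (ℤ.∣ a ∣ ℕ.* suc d)
    ∣n∣b≡ = begin
      ℤ.∣ n ∣ ℕ.* b                            ≡⟨ ℤ.abs-* n (+ b) ⟨
      ℤ.∣ n ℤ.* + b ∣                          ≡⟨ cong ℤ.∣_∣ nb≡ ⟩
      ℤ.∣ + (p ^ M) ℤ.* a ℤ.* + suc d ∣        ≡⟨ ℤ.abs-* (+ (p ^ M) ℤ.* a) (+ suc d) ⟩
      ℤ.∣ + (p ^ M) ℤ.* a ∣ ℕ.* suc d          ≡⟨ cong (ℕ._* suc d) (ℤ.abs-* (+ (p ^ M)) a) ⟩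
      p ^ M ℕ.* ℤ.∣ a ∣ ℕ.* suc d              ≡⟨ ℕ.*-assoc (p ^ M) ℤ.∣ a ∣ (suc d) ⟩
      p ^ M ℕ.* (ℤ.∣ a ∣ ℕ.* suc d)            ∎
      where open ≡-Reasoning
    p^M∣n : p ^ M ∣ ℤ.∣ n ∣
    p^M∣n = p^∣*-cancelʳ M p∤b (subst (p ^ M ∣_) (sym ∣n∣b≡) (m∣m*n _))
    p∤d+1 : ¬ p ∣ suc d
    p∤d+1 p∣d+1 = p∤1 (subst (p ∣_) (Coprime.recompute coprime (p∣n , p∣d+1)) ∣-refl)
      where
      p∣n : p ∣ ℤ.∣ n ∣
      p∣n = p∣*-cancelʳ p∤b (subst (p ∣_) (sym ∣n∣b≡) (∣n⇒∣m*n (p ^ M) (∣n⇒∣m*n ℤ.∣ a ∣ p∣d+1)))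

  InPow-0 : ∀ M → InPow p M 0ℚ
  InPow-0 M = (p ^ M) ∣0 , p∤1

  InPow-neg : ∀ {M} q → InPow p M q → InPow p M (ℚ.- q)
  InPow-neg (mkℚ -[1+ _ ] _ _) h = h
  InPow-neg (mkℚ +0       _ _) h = h
  InPow-neg (mkℚ +[1+ _ ] _ _) h = h

  InPow-+ : ∀ {M} x y → InPow p M x → InPow p M y → InPow p M (x ℚ.+ y)
  InPow-+ {M} x y hx hy = InPowᵘ⇒InPow (x ℚ.+ y) (InPowᵘ-cong (≃-sym (ℚₚ.toℚᵘ-homo-+ x y))
    (InPowᵘ-+ (InPow⇒InPowᵘ {M} x hx) (InPow⇒InPowᵘ {M} y hy)))

  InPow-* : ∀ {M N} x y → InPow p M x → InPow p N y → InPow p (M ℕ.+ N) (x ℚ.* y)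
  InPow-* {M} {N} x y hx hy = InPowᵘ⇒InPow (x ℚ.* y) (InPowᵘ-cong (≃-sym (ℚₚ.toℚᵘ-homo-* x y))
    (InPowᵘ-* (InPow⇒InPowᵘ {M} x hx) (InPow⇒InPowᵘ {N} y hy)))

  p^ℚ : ℕ → ℚ
  p^ℚ e = ℚ.fromℚᵘ (p^ᵘ e)

  private
    toℚᵘ-*p^ℚ : ∀ x e → ℚ.toℚᵘ (x ℚ.* p^ℚ e) ≃ ℚ.toℚᵘ x * p^ᵘ e
    toℚᵘ-*p^ℚ x e = ≃-trans (ℚₚ.toℚᵘ-homo-* x (p^ℚ e)) (*-congˡ {ℚ.toℚᵘ x} (ℚₚ.toℚᵘ-fromℚᵘ (p^ᵘ e)))

  InPow-p^ℚ : ∀ e → InPow p 0 (p^ℚ e)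
  InPow-p^ℚ e = InPowᵘ⇒InPow (p^ℚ e)
    (InPowᵘ-cong (≃-sym (ℚₚ.toℚᵘ-fromℚᵘ (p^ᵘ e))) (InPowᵘ-integer (+ (p ^ e))))

  InPow-cancel : ∀ {M} e x → InPow p (M ℕ.+ e) (x ℚ.* p^ℚ e) → InPow p M x
  InPow-cancel {M} e x h =
    InPowᵘ⇒InPow x (InPowᵘ-cancel e (InPowᵘ-cong (toℚᵘ-*p^ℚ x e) (InPow⇒InPowᵘ {M ℕ.+ e} (x ℚ.* p^ℚ e) h)))

  InPow-clear-denominator : ∀ q → ∃ λ e → InPow p 0 (q ℚ.* p^ℚ e)
  InPow-clear-denominator q@(mkℚ n d _) with e , h ← InPowᵘ-clear-denominator n d =
    e , InPowᵘ⇒InPow (q ℚ.* p^ℚ e) (InPowᵘ-cong (≃-sym (toℚᵘ-*p^ℚ q e)) h)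

module NullSequences (p : ℕ) ⦃ _ : NonZero p ⦄ (p-prime : Prime p) where
  open Integrality p p-prime
  open ℚ-Solver.+-*-Solver using (solve; _:+_; _:*_; _:-_; :-_; con; _:=_)

  infix  4 _≈_
  infixl 6 _⊕_ _⊖_
  infixl 7 _⊗_

  _≈_ : Seq p → Seq p → Set
  _≈_ = D._≈_ p

  _⊕_ _⊖_ _⊗_ : Seq p → Seq p → Seq p
  _⊕_ = D._⊕_ p
  _⊖_ = D._⊖_ p
  _⊗_ = D._⊗_ p

  ι : ℚ → Seq p
  ι = D.ι p

  Eventually : (ℕ → Set) → Set
  Eventually P = ∃ λ N → ∀ k → N ≤ k → P k

  eventually-map : ∀ {P Q : ℕ → Set} → (∀ {k} → P k → Q k) → Eventually P → Eventually Q
  eventually-map f (N , h) = N , λ k N≤k → f (h k N≤k)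

  eventually-× : ∀ {P Q : ℕ → Set} → Eventually P → Eventually Q → Eventually (λ k → P k × Q k)
  eventually-× (N , hP) (N′ , hQ) =
    N ⊔ N′ , λ k N⊔N′≤k → hP k (ℕ.m⊔n≤o⇒m≤o N N′ N⊔N′≤k) , hQ k (ℕ.m⊔n≤o⇒n≤o N N′ N⊔N′≤k)

  Null : Seq p → Set
  Null x = ∀ M → InPowSeq p M x

  Null-cong : ∀ {x y} → (∀ k → x k ≡ y k) → Null x → Null y
  Null-cong {x} {y} x≡y hx M = eventually-map (λ {k} → subst (InPow p M) (x≡y k)) (hx M)

  Null-0 : Null (ι 0ℚ)
  Null-0 M = 0 , λ _ _ → InPow-0 M

  Null-+ : ∀ {x y} → Null x → Null y → Null (x ⊕ y)
  Null-+ {x} {y} hx hy M =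
    eventually-map (λ {k} (x∈ , y∈) → InPow-+ {M} (x k) (y k) x∈ y∈) (eventually-× (hx M) (hy M))

  Null-neg : ∀ {x} → Null x → Null (λ k → ℚ.- x k)
  Null-neg {x} hx M = eventually-map (λ {k} → InPow-neg {M} (x k)) (hx M)

  cauchy⇒bounded : ∀ {z} → IsCauchy p z → ∃ λ e → Eventually (λ k → InPow p 0 (z k ℚ.* p^ℚ e))
  cauchy⇒bounded {z} z-cauchy
    with N , close ← z-cauchy 0
    with e , zN∈ ← InPow-clear-denominator (z N) =
    e , N , λ k N≤k → subst (InPow p 0) (split (z k) (z N) (p^ℚ e))
      (InPow-+ {0} ((z k ℚ.- z N) ℚ.* p^ℚ e) (z N ℚ.* p^ℚ e)
        (InPow-* {0} {0} (z k ℚ.- z N) (p^ℚ e) (close k N N≤k ℕ.≤-refl) (InPow-p^ℚ e)) zN∈)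
    where
    split : ∀ x y r → (x ℚ.- y) ℚ.* r ℚ.+ y ℚ.* r ≡ x ℚ.* r
    split = solve 3 (λ x y r → (x :- y) :* r :+ y :* r := x :* r) refl

  Null-*-bounded : ∀ {x z} e → Null x → Eventually (λ k → InPow p 0 (z k ℚ.* p^ℚ e)) → Null (x ⊗ z)
  Null-*-bounded {x} {z} e hx z-bounded M =
    eventually-map product∈ (eventually-× (hx (M ℕ.+ e)) z-bounded)
    where
    product∈ : ∀ {k} → InPow p (M ℕ.+ e) (x k) × InPow p 0 (z k ℚ.* p^ℚ e) → InPow p M (x k ℚ.* z k)
    product∈ {k} (x∈ , zr∈) = InPow-cancel {M} e (x k ℚ.* z k) (subst₂ (InPow p)
      (ℕ.+-identityʳ (M ℕ.+ e)) (sym (ℚₚ.*-assoc (x k) (z k) (p^ℚ e)))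
      (InPow-* {M ℕ.+ e} {0} (x k) (z k ℚ.* p^ℚ e) x∈ zr∈))

  Null-*-cauchy : ∀ {x z} → Null x → IsCauchy p z → Null (x ⊗ z)
  Null-*-cauchy {x} {z} hx z-cauchy =
    let e , z-bounded = cauchy⇒bounded {z} z-cauchy in Null-*-bounded {x} {z} e hx z-bounded

  cauchy-ι : ∀ c → IsCauchy p (ι c)
  cauchy-ι c M = 0 , λ _ _ _ _ → subst (InPow p M) (sym (ℚₚ.+-inverseʳ c)) (InPow-0 M)

  cauchy-⊖ι : ∀ {x} c → IsCauchy p x → IsCauchy p (x ⊖ ι c)
  cauchy-⊖ι {x} c x-cauchy M with N , close ← x-cauchy M =
    N , λ k l N≤k N≤l → subst (InPow p M) (sym (shift (x k) (x l) c)) (close k l N≤k N≤l)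
    where
    shift : ∀ x y c → (x ℚ.- c) ℚ.- (y ℚ.- c) ≡ x ℚ.- y
    shift = solve 3 (λ x y c → (x :- c) :- (y :- c) := x :- y) refl

  -- `_≈_ p` unfolds to a function type, so Agda cannot infer its arguments from it;
  -- the record wrapper makes them inferable.
  infix 4 _≋_
  record _≋_ (x y : Seq p) : Set where
    constructor ≈⇒≋
    field ≋⇒≈ : x ≈ y
  open _≋_ public

  Null⇒≋0 : ∀ {x} → Null x → x ≋ ι 0ℚ
  Null⇒≋0 {x} h = ≈⇒≋ (Null-cong (λ k → sym (ℚₚ.+-identityʳ (x k))) h)

  ≡⇒≋ : ∀ {x y} → (∀ k → x k ≡ y k) → x ≋ y
  ≡⇒≋ {x} {y} x≡y =
    ≈⇒≋ (Null-cong (λ k → trans (sym (ℚₚ.+-inverseʳ (x k))) (cong (λ u → x k ℚ.- u) (x≡y k))) Null-0)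

  ≋-sym : ∀ {x y} → x ≋ y → y ≋ x
  ≋-sym {x} {y} (≈⇒≋ x≈y) = ≈⇒≋ (Null-cong (λ k → flip (x k) (y k)) (Null-neg {x ⊖ y} x≈y))
    where
    flip : ∀ x y → ℚ.- (x ℚ.- y) ≡ y ℚ.- x
    flip = solve 2 (λ x y → :- (x :- y) := y :- x) refl

  ≋-trans : ∀ {x y z} → x ≋ y → y ≋ z → x ≋ z
  ≋-trans {x} {y} {z} (≈⇒≋ x≈y) (≈⇒≋ y≈z) =
    ≈⇒≋ (Null-cong (λ k → telescope (x k) (y k) (z k)) (Null-+ {x ⊖ y} {y ⊖ z} x≈y y≈z))
    where
    telescope : ∀ x y z → (x ℚ.- y) ℚ.+ (y ℚ.- z) ≡ x ℚ.- z
    telescope = solve 3 (λ x y z → (x :- y) :+ (y :- z) := x :- z) refl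

  ≋-setoid : Setoid 0ℓ 0ℓ
  ≋-setoid = record
    { Carrier       = Seq p
    ; _≈_           = _≋_
    ; isEquivalence = record { refl = ≡⇒≋ (λ _ → refl) ; sym = ≋-sym ; trans = ≋-trans }
    }

  ⊕-cong : ∀ {x x′ y y′} → x ≋ x′ → y ≋ y′ → x ⊕ y ≋ x′ ⊕ y′
  ⊕-cong {x} {x′} {y} {y′} (≈⇒≋ x≈x′) (≈⇒≋ y≈y′) =
    ≈⇒≋ (Null-cong (λ k → regroup (x k) (x′ k) (y k) (y′ k)) (Null-+ {x ⊖ x′} {y ⊖ y′} x≈x′ y≈y′))
    where
    regroup : ∀ x x′ y y′ → (x ℚ.- x′) ℚ.+ (y ℚ.- y′) ≡ (x ℚ.+ y) ℚ.- (x′ ℚ.+ y′)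
    regroup = solve 4 (λ x x′ y y′ → (x :- x′) :+ (y :- y′) := (x :+ y) :- (x′ :+ y′)) refl

  ⊗-congʳ : ∀ {x y z} → IsCauchy p z → x ≋ y → x ⊗ z ≋ y ⊗ z
  ⊗-congʳ {x} {y} {z} z-cauchy (≈⇒≋ x≈y) =
    ≈⇒≋ (Null-cong (λ k → distrib (x k) (y k) (z k)) (Null-*-cauchy {x ⊖ y} {z} x≈y z-cauchy))
    where
    distrib : ∀ x y z → (x ℚ.- y) ℚ.* z ≡ x ℚ.* z ℚ.- y ℚ.* z
    distrib = solve 3 (λ x y z → (x :- y) :* z := x :* z :- y :* z) refl

  ι⊗-cong : ∀ c {x y} → x ≋ y → ι c ⊗ x ≋ ι c ⊗ y
  ι⊗-cong c {x} {y} x≋y = begin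
    ι c ⊗ x   ≈⟨ ≡⇒≋ (λ k → ℚₚ.*-comm c (x k)) ⟩
    x ⊗ ι c   ≈⟨ ⊗-congʳ (cauchy-ι c) x≋y ⟩
    y ⊗ ι c   ≈⟨ ≡⇒≋ (λ k → ℚₚ.*-comm (y k) c) ⟩
    ι c ⊗ y   ∎
    where open ≈-Reasoning ≋-setoid

module JacobiPerron (p : ℕ) ⦃ _ : NonZero p ⦄ (p-prime : Prime p) where
  open NullSequences p p-prime
  open ℚ-Solver.+-*-Solver using (solve; _:+_; _:*_; _:-_; :-_; con; _:=_)

  linComb-coeff-ext : ∀ {c d} β j → (∀ i → 1 ≤ i → i ≤ j → c i ≡ d i) →
                      ∀ k → linComb p c β j k ≡ linComb p d β j k
  linComb-coeff-ext β zero    _   k = refl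
  linComb-coeff-ext β (suc j) c≡d k =
    cong₂ (λ u v → u ℚ.+ v ℚ.* seq (β (suc j)) k)
      (linComb-coeff-ext β j (λ i 1≤i i≤j → c≡d i 1≤i (ℕ.m≤n⇒m≤1+n i≤j)) k)
      (c≡d (suc j) (ℕ.s≤s ℕ.z≤n) ℕ.≤-refl)

  0+0*x≡0 : ∀ x → 0ℚ ℚ.+ 0ℚ ℚ.* x ≡ 0ℚ
  0+0*x≡0 = solve 1 (λ x → con 0ℚ :+ con 0ℚ :* x := con 0ℚ) refl

  linComb-zero : ∀ β j k → linComb p (λ _ → 0ℚ) β j k ≡ 0ℚ
  linComb-zero β zero    k = refl
  linComb-zero β (suc j) k =
    trans (cong (λ u → u ℚ.+ 0ℚ ℚ.* seq (β (suc j)) k) (linComb-zero β j k)) (0+0*x≡0 (seq (β (suc j)) k))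

  linComb-cong : ∀ c {β γ} j → (∀ i → 1 ≤ i → i ≤ j → seq (β i) ≋ seq (γ i)) →
                 linComb p c β j ≋ linComb p c γ j
  linComb-cong c zero    _   = ≡⇒≋ (λ _ → refl)
  linComb-cong c (suc j) β≋γ =
    ⊕-cong (linComb-cong c j (λ i 1≤i i≤j → β≋γ i 1≤i (ℕ.m≤n⇒m≤1+n i≤j)))
           (ι⊗-cong (c (suc j)) (β≋γ (suc j) (ℕ.s≤s ℕ.z≤n) ℕ.≤-refl))

  LinDep-cong : ∀ m {β γ} → (∀ i → 1 ≤ i → i ≤ m → seq (β i) ≋ seq (γ i)) → LinDep p m β → LinDep p m γ
  LinDep-cong m {β} {γ} β≋γ (c , nontrivial , relation) = c , nontrivial , ≋⇒≈ (begin
    ι (c 0) ⊕ linComb p c γ m   ≈⟨ ⊕-cong {ι (c 0)} (≡⇒≋ (λ _ → refl)) (linComb-cong c {β} {γ} m β≋γ) ⟨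
    ι (c 0) ⊕ linComb p c β m   ≈⟨ ≈⇒≋ relation ⟩
    ι 0ℚ                        ∎)
    where open ≈-Reasoning ≋-setoid

  ¬vanishes⇒nonTrivial : ∀ m (c : ℕ → ℚ) → ¬ (∀ i → i ≤ m → c i ≡ 0ℚ) → ∃ λ i → i ≤ m × ¬ c i ≡ 0ℚ
  ¬vanishes⇒nonTrivial m c ¬vanishes
    with ℕ.anyUpTo? (λ i → ¬? (c i ℚₚ.≟ 0ℚ)) (suc m)
  ... | yes (i , i<1+m , cᵢ≢0) = i , ℕ.s≤s⁻¹ i<1+m , cᵢ≢0
  ... | no ∄nonzero = ⊥-elim (¬vanishes λ i i≤m →
          decidable-stable (c i ℚₚ.≟ 0ℚ) (λ cᵢ≢0 → ∄nonzero (i , ℕ.s≤s i≤m , cᵢ≢0)))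

  module _ (m′ : ℕ) where
    private
      m : ℕ
      m = suc m′

    ⟨_∣_∣_⟩ : ℚ → (ℕ → ℚ) → ℚ → ℕ → ℚ
    ⟨ u ∣ c ∣ v ⟩ zero    = u
    ⟨ u ∣ c ∣ v ⟩ (suc i) with i ℕ.≟ m′
    ... | yes _ = v
    ... | no  _ = c (suc i)

    ⟨⟩-last : ∀ u c v → ⟨ u ∣ c ∣ v ⟩ m ≡ v
    ⟨⟩-last u c v with m′ ℕ.≟ m′
    ... | yes _    = refl
    ... | no m′≢m′ = ⊥-elim (m′≢m′ refl)

    ⟨⟩-middle : ∀ u c v i → 1 ≤ i → i ≤ m′ → ⟨ u ∣ c ∣ v ⟩ i ≡ c i
    ⟨⟩-middle u c v (suc i) _ i<m′ with i ℕ.≟ m′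
    ... | yes refl = ⊥-elim (ℕ.<-irrefl refl i<m′)
    ... | no  _    = refl

    linComb-⟨⟩ : ∀ u c v β k → linComb p ⟨ u ∣ c ∣ v ⟩ β m k ≡ linComb p c β m′ k ℚ.+ v ℚ.* seq (β m) k
    linComb-⟨⟩ u c v β k =
      cong₂ (λ x y → x ℚ.+ y ℚ.* seq (β m) k)
        (linComb-coeff-ext β m′ (⟨⟩-middle u c v) k) (⟨⟩-last u c v)

    rational-last⇒LinDep : ∀ {β} a → seq (β m) ≈ ι a → LinDep p m β
    rational-last⇒LinDep {β} a βₘ≈a = c , (m , ℕ.≤-refl , cₘ≢0) , ≋⇒≈ (begin
      ι (c 0) ⊕ linComb p c β m   ≈⟨ ≡⇒≋ expand ⟩
      seq (β m) ⊖ ι a             ≈⟨ Null⇒≋0 βₘ≈a ⟩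
      ι 0ℚ                        ∎)
      where
      open ≈-Reasoning ≋-setoid
      c : ℕ → ℚ
      c = ⟨ ℚ.- a ∣ (λ _ → 0ℚ) ∣ 1ℚ ⟩
      cₘ≢0 : ¬ c m ≡ 0ℚ
      cₘ≢0 cₘ≡0 with () ← trans (sym (⟨⟩-last (ℚ.- a) (λ _ → 0ℚ) 1ℚ)) cₘ≡0
      rearrange : ∀ a x → ℚ.- a ℚ.+ (0ℚ ℚ.+ 1ℚ ℚ.* x) ≡ x ℚ.- a
      rearrange = solve 2 (λ a x → :- a :+ (con 0ℚ :+ con 1ℚ :* x) := x :- a) refl
      expand : ∀ k → ℚ.- a ℚ.+ linComb p c β m k ≡ seq (β m) k ℚ.- a
      expand k = trans
        (cong (ℚ.- a ℚ.+_) (trans (linComb-⟨⟩ (ℚ.- a) (λ _ → 0ℚ) 1ℚ β k)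
                                  (cong (ℚ._+ 1ℚ ℚ.* seq (β m) k) (linComb-zero β m′ k))))
        (rearrange a (seq (β m) k))

    module JacobiPerronStep {β γ : ℕ → ℚp p} (a : ℕ → ℚ)
      (step₁ : seq (β 1) ⊗ (seq (γ m) ⊖ ι (a m)) ≈ ι 1ℚ)
      (stepᵢ : ∀ i → 2 ≤ i → i ≤ m →
                 seq (β i) ⊗ (seq (γ m) ⊖ ι (a m)) ≈ seq (γ (i ℕ.∸ 1)) ⊖ ι (a (i ℕ.∸ 1))) where

      D : Seq p
      D = seq (γ m) ⊖ ι (a m)

      module _ (c : ℕ → ℚ) where

        σ : ℕ → ℚ
        σ zero    = 0ℚ
        σ (suc j) = σ j ℚ.+ c (2 ℕ.+ j) ℚ.* a (suc j)

        -- The relation obtained by multiplying the relation c for β by D (see `relation-backward`).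
        c′ : ℕ → ℚ
        c′ = ⟨ c 1 ℚ.- c 0 ℚ.* a m ℚ.- σ m′ ∣ c ∘ suc ∣ c 0 ⟩

        linComb⊗D : ∀ j → suc j ≤ m →
                    linComb p c β (suc j) ⊗ D ≋ ι (c 1 ℚ.- σ j) ⊕ linComb p (c ∘ suc) γ j
        linComb⊗D zero _ = begin
          linComb p c β 1 ⊗ D                 ≈⟨ ≡⇒≋ (λ k → reassoc (c 1) (seq (β 1) k) (D k)) ⟩
          ι (c 1) ⊗ (seq (β 1) ⊗ D)           ≈⟨ ι⊗-cong (c 1) (≈⇒≋ step₁) ⟩
          ι (c 1) ⊗ ι 1ℚ                      ≈⟨ ≡⇒≋ (λ _ → unit (c 1)) ⟩
          ι (c 1 ℚ.- σ 0) ⊕ linComb p (c ∘ suc) γ 0   ∎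
          where
          open ≈-Reasoning ≋-setoid
          reassoc : ∀ c b d → (0ℚ ℚ.+ c ℚ.* b) ℚ.* d ≡ c ℚ.* (b ℚ.* d)
          reassoc = solve 3 (λ c b d → (con 0ℚ :+ c :* b) :* d := c :* (b :* d)) refl
          unit : ∀ c → c ℚ.* 1ℚ ≡ (c ℚ.- 0ℚ) ℚ.+ 0ℚ
          unit = solve 1 (λ c → c :* con 1ℚ := (c :- con 0ℚ) :+ con 0ℚ) refl
        linComb⊗D (suc j) 2+j≤m = begin
          linComb p c β (2 ℕ.+ j) ⊗ D
            ≈⟨ ≡⇒≋ (λ k → distrib (linComb p c β (suc j) k) (c (2 ℕ.+ j)) (seq (β (2 ℕ.+ j)) k) (D k)) ⟩
          linComb p c β (suc j) ⊗ D ⊕ ι (c (2 ℕ.+ j)) ⊗ (seq (β (2 ℕ.+ j)) ⊗ D)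
            ≈⟨ ⊕-cong (linComb⊗D j (ℕ.<⇒≤ 2+j≤m))
                      (ι⊗-cong (c (2 ℕ.+ j)) (≈⇒≋ (stepᵢ (2 ℕ.+ j) (ℕ.s≤s (ℕ.s≤s ℕ.z≤n)) 2+j≤m))) ⟩
          ι (c 1 ℚ.- σ j) ⊕ linComb p (c ∘ suc) γ j ⊕ ι (c (2 ℕ.+ j)) ⊗ (seq (γ (suc j)) ⊖ ι (a (suc j)))
            ≈⟨ ≡⇒≋ (λ k → collect (c 1) (σ j) (linComb p (c ∘ suc) γ j k)
                                   (c (2 ℕ.+ j)) (seq (γ (suc j)) k) (a (suc j))) ⟩
          ι (c 1 ℚ.- σ (suc j)) ⊕ linComb p (c ∘ suc) γ (suc j)   ∎
          where
          open ≈-Reasoning ≋-setoid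
          distrib : ∀ l c b d → (l ℚ.+ c ℚ.* b) ℚ.* d ≡ l ℚ.* d ℚ.+ c ℚ.* (b ℚ.* d)
          distrib = solve 4 (λ l c b d → (l :+ c :* b) :* d := l :* d :+ c :* (b :* d)) refl
          collect : ∀ c₁ s l c g a →
                    (c₁ ℚ.- s) ℚ.+ l ℚ.+ c ℚ.* (g ℚ.- a) ≡ (c₁ ℚ.- (s ℚ.+ c ℚ.* a)) ℚ.+ (l ℚ.+ c ℚ.* g)
          collect = solve 6 (λ c₁ s l c g a →
            (c₁ :- s) :+ l :+ c :* (g :- a) := (c₁ :- (s :+ c :* a)) :+ (l :+ c :* g)) refl

        relation-backward : ι (c 0) ⊕ linComb p c β m ≋ ι 0ℚ → ι (c′ 0) ⊕ linComb p c′ γ m ≋ ι 0ℚ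
        relation-backward c-relation = begin
          ι (c′ 0) ⊕ linComb p c′ γ m
            ≈⟨ ≡⇒≋ (λ k → cong (c′ 0 ℚ.+_) (linComb-⟨⟩ (c′ 0) (c ∘ suc) (c 0) γ k)) ⟩
          ι (c′ 0) ⊕ (linComb p (c ∘ suc) γ m′ ⊕ ι (c 0) ⊗ seq (γ m))
            ≈⟨ ≡⇒≋ (λ k → regroup (c 1) (c 0) (a m) (σ m′) (linComb p (c ∘ suc) γ m′ k) (seq (γ m) k)) ⟩
          ι (c 1 ℚ.- σ m′) ⊕ linComb p (c ∘ suc) γ m′ ⊕ ι (c 0) ⊗ D
            ≈⟨ ⊕-cong (≋-sym (linComb⊗D m′ ℕ.≤-refl)) (≡⇒≋ (λ _ → refl)) ⟩
          linComb p c β m ⊗ D ⊕ ι (c 0) ⊗ D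
            ≈⟨ ≡⇒≋ (λ k → factor (c 0) (linComb p c β m k) (D k)) ⟩
          (ι (c 0) ⊕ linComb p c β m) ⊗ D
            ≈⟨ ⊗-congʳ (cauchy-⊖ι {seq (γ m)} (a m) (cauchy (γ m))) c-relation ⟩
          ι 0ℚ ⊗ D
            ≈⟨ ≡⇒≋ (λ k → ℚₚ.*-zeroˡ (D k)) ⟩
          ι 0ℚ   ∎
          where
          open ≈-Reasoning ≋-setoid
          regroup : ∀ c₁ c₀ a s l g →
                    (c₁ ℚ.- c₀ ℚ.* a ℚ.- s) ℚ.+ (l ℚ.+ c₀ ℚ.* g) ≡ (c₁ ℚ.- s) ℚ.+ l ℚ.+ c₀ ℚ.* (g ℚ.- a)
          regroup = solve 6 (λ c₁ c₀ a s l g →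
            (c₁ :- c₀ :* a :- s) :+ (l :+ c₀ :* g) := (c₁ :- s) :+ l :+ c₀ :* (g :- a)) refl
          factor : ∀ c₀ l d → l ℚ.* d ℚ.+ c₀ ℚ.* d ≡ (c₀ ℚ.+ l) ℚ.* d
          factor = solve 3 (λ c₀ l d → l :* d :+ c₀ :* d := (c₀ :+ l) :* d) refl

        c′-vanishes⇒c-vanishes : (∀ i → i ≤ m → c′ i ≡ 0ℚ) → ∀ i → i ≤ m → c i ≡ 0ℚ
        c′-vanishes⇒c-vanishes c′≡0 = c≡0
          where
          open ≡-Reasoning
          c₀≡0 : c 0 ≡ 0ℚ
          c₀≡0 = trans (sym (⟨⟩-last (c′ 0) (c ∘ suc) (c 0))) (c′≡0 m ℕ.≤-refl)
          c₂₊ⱼ≡0 : ∀ j → 2 ℕ.+ j ≤ m → c (2 ℕ.+ j) ≡ 0ℚ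
          c₂₊ⱼ≡0 j 2+j≤m =
            trans (sym (⟨⟩-middle (c′ 0) (c ∘ suc) (c 0) (suc j) (ℕ.s≤s ℕ.z≤n) (ℕ.s≤s⁻¹ 2+j≤m)))
                  (c′≡0 (suc j) (ℕ.<⇒≤ 2+j≤m))
          σ≡0 : ∀ j → j ≤ m′ → σ j ≡ 0ℚ
          σ≡0 zero    _    = refl
          σ≡0 (suc j) j<m′ = begin
            σ j ℚ.+ c (2 ℕ.+ j) ℚ.* a (suc j)
              ≡⟨ cong₂ (λ x y → x ℚ.+ y ℚ.* a (suc j)) (σ≡0 j (ℕ.<⇒≤ j<m′)) (c₂₊ⱼ≡0 j (ℕ.s≤s j<m′)) ⟩
            0ℚ ℚ.+ 0ℚ ℚ.* a (suc j)
              ≡⟨ 0+0*x≡0 (a (suc j)) ⟩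
            0ℚ ∎
          recover : ∀ c₁ c₀ a s → c₁ ≡ (c₁ ℚ.- c₀ ℚ.* a ℚ.- s) ℚ.+ c₀ ℚ.* a ℚ.+ s
          recover = solve 4 (λ c₁ c₀ a s → c₁ := (c₁ :- c₀ :* a :- s) :+ c₀ :* a :+ s) refl
          c≡0 : ∀ i → i ≤ m → c i ≡ 0ℚ
          c≡0 zero          _     = c₀≡0
          c≡0 (suc zero)    _     = begin
            c 1                              ≡⟨ recover (c 1) (c 0) (a m) (σ m′) ⟩
            c′ 0 ℚ.+ c 0 ℚ.* a m ℚ.+ σ m′    ≡⟨ cong₂ (λ x y → x ℚ.+ y ℚ.* a m ℚ.+ σ m′) (c′≡0 0 ℕ.z≤n) c₀≡0 ⟩
            0ℚ ℚ.+ 0ℚ ℚ.* a m ℚ.+ σ m′       ≡⟨ cong (0ℚ ℚ.+ 0ℚ ℚ.* a m ℚ.+_) (σ≡0 m′ ℕ.≤-refl) ⟩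
            0ℚ ℚ.+ 0ℚ ℚ.* a m ℚ.+ 0ℚ         ≡⟨ ℚₚ.+-identityʳ _ ⟩
            0ℚ ℚ.+ 0ℚ ℚ.* a m                ≡⟨ 0+0*x≡0 (a m) ⟩
            0ℚ                               ∎
          c≡0 (suc (suc j)) 2+j≤m = c₂₊ⱼ≡0 j 2+j≤m

      LinDep-backward : LinDep p m β → LinDep p m γ
      LinDep-backward (c , (i , i≤m , cᵢ≢0) , c-relation) =
        c′ c , ¬vanishes⇒nonTrivial m (c′ c) (λ c′≡0 → cᵢ≢0 (c′-vanishes⇒c-vanishes c c′≡0 i i≤m)) ,
        ≋⇒≈ (relation-backward c (≈⇒≋ c-relation))

    JPStopsAt⇒LinDep : ∀ {α T A a} → JPStopsAt p m α T A a → LinDep p m α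
    JPStopsAt⇒LinDep {α} {T} {A} {a} run =
      LinDep-cong m {A 0} {α} (λ i 1≤i i≤m → ≈⇒≋ (init i 1≤i i≤m)) (dependent T 0 refl)
      where
      open JPStopsAt run
      dependent : ∀ k n → n ℕ.+ k ≡ T → LinDep p m (A n)
      dependent zero    n n+0≡T =
        subst (LinDep p m ∘ A) (trans (sym n+0≡T) (ℕ.+-identityʳ n)) (rational-last⇒LinDep (a T m) stops)
      dependent (suc k) n n+1+k≡T =
        JacobiPerronStep.LinDep-backward (a n) (step₁ n n<T) (λ i → stepᵢ n i n<T)
          (dependent k (suc n) (trans (sym (ℕ.+-suc n k)) n+1+k≡T))
        where
        n<T : n < T
        n<T = subst (n <_) n+1+k≡T (ℕ.m<m+n n (ℕ.s≤s ℕ.z≤n))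

proposition4p7 : (p : ℕ) ⦃ _ : NonZero p ⦄ → Prime p → ¬ (2 ∣ p) →
    (m : ℕ) → 1 ≤ m → (α : ℕ → ℚp p) →
    JPStops p m α → LinDep p m α
proposition4p7 p p-prime _ zero     () α _
proposition4p7 p p-prime _ (suc m′) _  α (T , A , a , run) =
  JacobiPerron.JPStopsAt⇒LinDep p p-prime m′ run
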